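{- Let $r\ge2$ and $N\ge r$ be integers, $q$ a prime power with $q\equiv1\pmod{2r}$, and $F\in\mathbb{F}_q[T]$ a nonzero monic polynomial. Then $$\frac{1}{|\mathcal{H}_r(N)|}\sum_{G\in\mathcal{H}_r(N)}\chi_{F^r}(G)=1+O\left(\frac{\tau(F)}{q}\right),$$ where $\tau(F)$ is the number of monic divisors of $F$ and the implied constant is independent of $q$.
   Context: "Prime" means monic irreducible polynomial in $\mathbb{F}_q[T]$. $\mathcal{H}_r(N)$ is the set of monic $r$-th power free polynomials of degree $N$. For monic $H$, $\chi_H(G)=\left(\frac{G}{H}\right)_r$ is the $r$-th power residue symbol: for a prime $P$, $\left(\frac{G}{P}\right)_r=0$ if $P\mid G$ and otherwise is the $r$-th root of unity congruent to $G^{(q^{\deg P}-1)/r}$ mod $P$ (viewed in $\mathbb{C}$), extended multiplicatively in the lower argument. In particular $\chi_{F^r}(G)=1$ if $\gcd(F,G)=1$ and $0$ otherwise. -}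

module Defs where

open import Level using (0ℓ)
open import Data.Nat using (ℕ; zero; suc)
open import Data.Fin using (Fin)
open import Data.List using (List; []; _∷_; map; _++_; [_])
open import Data.Vec using (Vec; toList)
open import Data.Product using (Σ; ∃; _×_; _,_)
open import Data.Unit using (⊤)
open import Relation.Binary.PropositionalEquality using (_≡_; _≢_)
open import Relation.Nullary using (¬_)
open import Algebra.Core using (Op₁; Op₂)
open import Algebra.Structures using (IsCommutativeRing)
open import Function.Bundles using (_↔_)
open import Data.List.Membership.Propositional using (_∈_)
open import Data.List.Relation.Unary.Unique.Propositional using (Unique)

Enumerates : {A : Set} → (A → Set) → List A → Set
Enumerates P xs = Unique xs × (∀ x → (x ∈ xs → P x) × (P x → x ∈ xs))

record FiniteField (q : ℕ) : Set₁ where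
  field
    Carrier  : Set
    0# 1#    : Carrier
    _+_ _*_  : Op₂ Carrier
    -_       : Op₁ Carrier
    isCommutativeRing : IsCommutativeRing {A = Carrier} _≡_ _+_ _*_ -_ 0# 1#
    0≢1      : 0# ≢ 1#
    inverse  : ∀ x → x ≢ 0# → ∃ λ y → x * y ≡ 1#
    card     : Carrier ↔ Fin q

module Poly {q : ℕ} (K : FiniteField q) where
  open FiniteField K

  -- polynomials in F_q[T] as coefficient lists, lowest degree first
  Pol : Set
  Pol = List Carrier

  -- equality of polynomials (ignoring trailing zero coefficients)
  _≈ₚ_ : Pol → Pol → Set
  []       ≈ₚ []       = ⊤
  []       ≈ₚ (b ∷ bs) = (b ≡ 0#) × ([] ≈ₚ bs)
  (a ∷ as) ≈ₚ []       = (a ≡ 0#) × (as ≈ₚ [])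
  (a ∷ as) ≈ₚ (b ∷ bs) = (a ≡ b) × (as ≈ₚ bs)

  _+ₚ_ : Pol → Pol → Pol
  []       +ₚ g        = g
  (a ∷ f)  +ₚ []       = a ∷ f
  (a ∷ f)  +ₚ (b ∷ g)  = (a + b) ∷ (f +ₚ g)

  _*ₚ_ : Pol → Pol → Pol
  []      *ₚ g = []
  (a ∷ f) *ₚ g = map (a *_) g +ₚ (0# ∷ (f *ₚ g))

  oneₚ : Pol
  oneₚ = [ 1# ]

  _^ₚ_ : Pol → ℕ → Pol
  f ^ₚ zero  = oneₚ
  f ^ₚ suc n = f *ₚ (f ^ₚ n)

  _∣ₚ_ : Pol → Pol → Set
  f ∣ₚ g = ∃ λ h → (f *ₚ h) ≈ₚ g

  IsUnit : Pol → Set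
  IsUnit f = f ∣ₚ oneₚ

  -- monic polynomial of degree n: lower coefficients c₀..c_{n-1}, leading coefficient 1
  Monic : ℕ → Set
  Monic n = Vec Carrier n

  toPol : ∀ {n} → Monic n → Pol
  toPol v = toList v ++ [ 1# ]

  AnyMonic : Set
  AnyMonic = Σ ℕ Monic

  anyToPol : AnyMonic → Pol
  anyToPol (n , v) = toPol v

  Coprime : Pol → Pol → Set
  Coprime f g = ∀ d → d ∣ₚ f → d ∣ₚ g → IsUnit d

  PowerFree : ℕ → Pol → Set
  PowerFree r f = ∀ p → (p ^ₚ r) ∣ₚ f → IsUnit p

  InH : (r N : ℕ) → Monic N → Set
  InH r N G = PowerFree r (toPol G)

  -- χ_{F^r}(G) ≠ 0 (then it equals 1); cf. context: χ_{F^r}(G) = 1 iff gcd(F,G)=1, else 0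
  ChiFrIsOne : (F : AnyMonic) → ∀ {N} → Monic N → Set
  ChiFrIsOne F G = Coprime (anyToPol F) (toPol G)

{-# OPTIONS --safe #-}
module Submission where

-- A G ∈ 𝓗_r(N) that is not coprime to F shares with F a non-unit factor, whose monic associate D
-- is a divisor of F of degree d ≥ 1; so G is one of the q^(N-d) ≤ q^(N-1) monic multiples of D,
-- and at most τ(F) q^(N-1) elements of 𝓗_r(N) have χ_{F^r}(G) = 0. A monic G of degree N outside
-- 𝓗_r(N) (r ≥ 2) is divisible by P² for a monic P of some degree d ≥ 1, leaving at most
-- Σ_{d≥1} q^(N-d) < q^N/2 such G when q ≥ 3. Hence q^N ≤ 2|𝓗_r(N)|, and q times the deviation
-- is at most τ(F) q^N ≤ 2 τ(F) |𝓗_r(N)|.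

open import Defs
open import Data.Nat using (ℕ; _≤_; _*_; _∸_)
open import Data.Nat.Divisibility using (_∣_)
open import Data.Integer using (+_; _-_; ∣_∣)
open import Data.List using (List; length)
open import Data.Product using (∃; _×_)

open import Level using (0ℓ)
open import Data.Nat as ℕ using (zero; suc; _+_; _^_; _<_; z≤n; s≤s; _≤?_)
open import Data.Nat.Properties
  using ( ≤-refl; ≤-reflexive; ≤-trans; <⇒≤; <-cmp; m≤n⇒m<n∨m≡n; m≤n+m; m≤m+n; m∸n≤m; n∸n≡0
        ; m+n∸m≡n; m+[n∸m]≡n; +-∸-assoc; m≤n+o⇒m∸n≤o; ∸-monoʳ-≤; +-comm; +-mono-≤; +-monoˡ-≤
        ; +-monoʳ-<; +-cancelʳ-<; *-monoˡ-≤; *-monoʳ-≤; ^-monoʳ-≤; ^-distribˡ-+-*; module ≤-Reasoning)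
open import Data.Nat.Divisibility using (∣⇒≤)
open import Data.Nat.Tactic.RingSolver using (solve-∀)
import Data.Integer.Properties as ℤ
open import Data.Fin using (Fin)
open import Data.Fin.Properties using (inj⇒≟)
open import Data.List using ([]; _∷_; map; _++_; [_]; concatMap; cartesianProductWith; allFin)
open import Data.List.Properties using (length-++; length-map; length-++-sucʳ; length-tabulate)
open import Data.List.Membership.Propositional using (_∈_; _∉_; lose)
open import Data.List.Membership.Propositional.Properties
  using (∈-++⁺ˡ; ∈-++⁺ʳ; ∈-++⁻; ∈-∃++; ∈-map⁺; ∈-allFin; ∈-concatMap⁺; ∈-cartesianProductWith⁺)
import Data.List.Membership.DecPropositional as DecMembership
open import Data.List.Relation.Unary.Any using (here; there)
open import Data.List.Relation.Unary.All as All using ()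
open import Data.List.Relation.Unary.AllPairs using ([]; _∷_)
open import Data.List.Relation.Unary.Unique.Propositional using (Unique)
import Data.List.Relation.Unary.Unique.Propositional.Properties as Unique
open import Data.Vec using () renaming ([] to []ᵥ; _∷_ to _∷ᵥ_)
open import Data.Vec.Properties using (≡-dec)
open import Data.Product using (_,_; proj₁; proj₂)
open import Data.Sum using (_⊎_; inj₁; inj₂)
open import Data.Unit using (tt)
open import Function.Bundles using (Inverse; Injection)
open import Function.Properties.Inverse using (↔⇒↣; ↔-sym)
open import Relation.Binary.Bundles using (Setoid)
open import Relation.Binary.Definitions using (DecidableEquality; tri<; tri≈; tri>)
open import Relation.Binary.PropositionalEquality using (_≡_; _≢_; refl; sym; trans; cong; cong₂; subst; module ≡-Reasoning)
import Relation.Binary.Reasoning.Setoid as SetoidReasoning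
open import Relation.Nullary using (¬_; yes; no; contradiction)
open import Algebra.Bundles using (CommutativeRing)
import Algebra.Properties.CommutativeSemigroup as CommutativeSemigroupProperties

module _ {A : Set} where

  unique-⊆⇒length≤ : {xs ys : List A} → Unique xs → (∀ {x} → x ∈ xs → x ∈ ys) → length xs ≤ length ys
  unique-⊆⇒length≤ {[]}     _               _     = z≤n
  unique-⊆⇒length≤ {x ∷ xs} (x∉xs ∷ unique) xs⊆ys with ∈-∃++ (xs⊆ys (here refl))
  ... | ys₁ , ys₂ , refl = begin
      suc (length xs)            ≤⟨ s≤s (unique-⊆⇒length≤ unique xs⊆ys₁ys₂) ⟩
      suc (length (ys₁ ++ ys₂))  ≡⟨ length-++-sucʳ ys₁ x ys₂ ⟨
      length (ys₁ ++ x ∷ ys₂)    ∎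
    where
    open ≤-Reasoning
    xs⊆ys₁ys₂ : ∀ {y} → y ∈ xs → y ∈ ys₁ ++ ys₂
    xs⊆ys₁ys₂ y∈xs with ∈-++⁻ ys₁ (xs⊆ys (there y∈xs))
    ... | inj₁ y∈ys₁         = ∈-++⁺ˡ y∈ys₁
    ... | inj₂ (here refl)   = contradiction refl (All.lookup x∉xs y∈xs)
    ... | inj₂ (there y∈ys₂) = ∈-++⁺ʳ ys₁ y∈ys₂

  length-cover : DecidableEquality A → {xs ys zs : List A} → Unique xs →
                 (∀ {x} → x ∈ xs → x ∉ zs → x ∈ ys) → length xs ≤ length ys + length zs
  length-cover _≟_ {xs} {ys} {zs} unique cover = begin
      length xs             ≤⟨ unique-⊆⇒length≤ unique xs⊆ys++zs ⟩
      length (ys ++ zs)     ≡⟨ length-++ ys ⟩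
      length ys + length zs ∎
    where
    open ≤-Reasoning
    open DecMembership _≟_ using (_∈?_)
    xs⊆ys++zs : ∀ {x} → x ∈ xs → x ∈ ys ++ zs
    xs⊆ys++zs {x} x∈xs with x ∈? zs
    ... | yes x∈zs = ∈-++⁺ʳ ys x∈zs
    ... | no  x∉zs = ∈-++⁺ˡ (cover x∈xs x∉zs)

  length-concatMap-≤ : {B : Set} (f : A → List B) {b : ℕ} → (∀ x → length (f x) ≤ b) →
                       ∀ xs → length (concatMap f xs) ≤ length xs * b
  length-concatMap-≤ f bound []       = z≤n
  length-concatMap-≤ f {b} bound (x ∷ xs) = begin
      length (f x ++ concatMap f xs)         ≡⟨ length-++ (f x) ⟩
      length (f x) + length (concatMap f xs) ≤⟨ +-mono-≤ (bound x) (length-concatMap-≤ f bound xs) ⟩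
      b + length xs * b                      ∎
    where open ≤-Reasoning

  length-cartesianProductWith : {B C : Set} (f : A → B → C) (xs : List A) (ys : List B) →
                                length (cartesianProductWith f xs ys) ≡ length xs * length ys
  length-cartesianProductWith f []       ys = refl
  length-cartesianProductWith f (x ∷ xs) ys = begin
      length (map (f x) ys ++ cartesianProductWith f xs ys)        ≡⟨ length-++ (map (f x) ys) ⟩
      length (map (f x) ys) + length (cartesianProductWith f xs ys) ≡⟨ cong₂ _+_ (length-map (f x) ys) (length-cartesianProductWith f xs ys) ⟩
      length ys + length xs * length ys                             ∎
    where open ≡-Reasoning

geometric-bound : ∀ {q N} → 3 ≤ q → (s : ℕ → ℕ) → s 0 ≡ 0 →
                  (∀ j → s (suc j) ≤ q ^ (N ∸ suc j) + s j) →
                  ∀ j → j ≤ N → 2 * s j + q ^ (N ∸ j) ≤ q ^ N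
geometric-bound q≥3 s s₀≡0 step zero    _ rewrite s₀≡0 = ≤-refl
geometric-bound {q} {N} q≥3 s s₀≡0 step (suc j) j<N = begin
    2 * s (suc j) + t      ≤⟨ +-monoˡ-≤ t (*-monoʳ-≤ 2 (step j)) ⟩
    2 * (t + s j) + t      ≡⟨ rearrange t (s j) ⟩
    3 * t + 2 * s j        ≤⟨ +-monoˡ-≤ (2 * s j) (*-monoˡ-≤ t q≥3) ⟩
    q * t + 2 * s j        ≡⟨ +-comm (q * t) (2 * s j) ⟩
    2 * s j + q * t        ≡⟨ cong (λ e → 2 * s j + q ^ e) (+-∸-assoc 1 j<N) ⟨
    2 * s j + q ^ (N ∸ j)  ≤⟨ geometric-bound q≥3 s s₀≡0 step j (<⇒≤ j<N) ⟩
    q ^ N                  ∎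
  where
  open ≤-Reasoning
  t = q ^ (N ∸ suc j)
  rearrange : ∀ t s → 2 * (t + s) + t ≡ 3 * t + 2 * s
  rearrange = solve-∀

m≤n+o∧2o<m⇒m≤2n : ∀ {m n o} → m ≤ n + o → 2 * o < m → m ≤ 2 * n
m≤n+o∧2o<m⇒m≤2n {m} {n} {o} m≤n+o 2o<m = <⇒≤ (+-cancelʳ-< m m (2 * n) (begin-strict
    m + m                ≤⟨ +-mono-≤ m≤n+o m≤n+o ⟩
    (n + o) + (n + o)    ≡⟨ rearrange n o ⟩
    2 * n + 2 * o        <⟨ +-monoʳ-< (2 * n) 2o<m ⟩
    2 * n + m            ∎))
  where
  open ≤-Reasoning
  rearrange : ∀ n o → (n + o) + (n + o) ≡ 2 * n + 2 * o
  rearrange = solve-∀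

fieldSize≥2 : ∀ {q} → FiniteField q → 2 ≤ q
fieldSize≥2 {zero} K with Inverse.to (FiniteField.card K) (FiniteField.0# K)
... | ()
fieldSize≥2 {suc zero} K =
  contradiction (Injection.injective (↔⇒↣ card) (all-equal _ _)) 0≢1
  where
  open FiniteField K using (card; 0≢1)
  all-equal : (i j : Fin 1) → i ≡ j
  all-equal Fin.zero Fin.zero = refl
fieldSize≥2 {suc (suc _)} K = s≤s (s≤s z≤n)

fieldSize≥3 : ∀ {q m} → FiniteField q → 2 ≤ m → m ∣ q ∸ 1 → 3 ≤ q
fieldSize≥3 K 2≤m m∣q-1 with fieldSize≥2 K
... | s≤s (s≤s _) = s≤s (≤-trans 2≤m (∣⇒≤ m∣q-1))

module _ {q : ℕ} (K : FiniteField q) where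
  open FiniteField K renaming (_+_ to infixl 6 _⊕_; _*_ to infixl 7 _⊛_)
  open Poly K

  private
    ring : CommutativeRing 0ℓ 0ℓ
    ring = record { isCommutativeRing = isCommutativeRing }
    open CommutativeRing ring
      using (+-identityˡ; +-identityʳ; *-assoc; *-comm; *-identityˡ; distribˡ; distribʳ; zeroˡ; zeroʳ
            ; +-commutativeSemigroup; *-commutativeSemigroup)
    open CommutativeSemigroupProperties +-commutativeSemigroup using (interchange)
    open CommutativeSemigroupProperties *-commutativeSemigroup using (x∙yz≈y∙xz)

  _≟_ : DecidableEquality Carrier
  _≟_ = inj⇒≟ (↔⇒↣ card)

  coeff : Pol → ℕ → Carrier
  coeff []      i       = 0#
  coeff (a ∷ f) zero    = a
  coeff (a ∷ f) (suc i) = coeff f i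

  infix 4 _≐_
  record _≐_ (f g : Pol) : Set where
    constructor coeffwise
    field at : ∀ i → coeff f i ≡ coeff g i
  open _≐_

  ≐-setoid : Setoid 0ℓ 0ℓ
  ≐-setoid = record
    { Carrier       = Pol
    ; _≈_           = _≐_
    ; isEquivalence = record
      { refl  = coeffwise λ _ → refl
      ; sym   = λ f≐g → coeffwise λ i → sym (at f≐g i)
      ; trans = λ f≐g g≐h → coeffwise λ i → trans (at f≐g i) (at g≐h i)
      }
    }
  open Setoid ≐-setoid public using () renaming (refl to ≐-refl; sym to ≐-sym; trans to ≐-trans)

  ≈ₚ⇒≐ : ∀ {f g} → f ≈ₚ g → f ≐ g
  ≈ₚ⇒≐ {f} {g} f≈g = coeffwise (go f g f≈g)
    where
    go : ∀ f g → f ≈ₚ g → ∀ i → coeff f i ≡ coeff g i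
    go []      []      _             i       = refl
    go []      (b ∷ g) (b≡0 , _)     zero    = sym b≡0
    go []      (b ∷ g) (_ , []≈g)    (suc i) = go [] g []≈g i
    go (a ∷ f) []      (a≡0 , _)     zero    = a≡0
    go (a ∷ f) []      (_ , f≈[])    (suc i) = go f [] f≈[] i
    go (a ∷ f) (b ∷ g) (a≡b , _)     zero    = a≡b
    go (a ∷ f) (b ∷ g) (_ , f≈g)     (suc i) = go f g f≈g i

  ∷-cong : ∀ {a b f g} → a ≡ b → f ≐ g → a ∷ f ≐ b ∷ g
  ∷-cong a≡b f≐g = coeffwise λ { zero → a≡b ; (suc i) → at f≐g i }

  ∷-tail : ∀ {a b f g} → a ∷ f ≐ b ∷ g → f ≐ g
  ∷-tail e = coeffwise λ i → at e (suc i)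

  ≐⇒≈ₚ : ∀ {f g} → f ≐ g → f ≈ₚ g
  ≐⇒≈ₚ {[]}    {[]}    e = tt
  ≐⇒≈ₚ {[]}    {b ∷ g} e = sym (at e zero) , ≐⇒≈ₚ (coeffwise λ i → at e (suc i))
  ≐⇒≈ₚ {a ∷ f} {[]}    e = at e zero , ≐⇒≈ₚ (coeffwise λ i → at e (suc i))
  ≐⇒≈ₚ {a ∷ f} {b ∷ g} e = at e zero , ≐⇒≈ₚ (∷-tail e)

  infixr 25 _·ₚ_
  _·ₚ_ : Carrier → Pol → Pol
  c ·ₚ f = map (c ⊛_) f

  coeff-+ₚ : ∀ f g i → coeff (f +ₚ g) i ≡ coeff f i ⊕ coeff g i
  coeff-+ₚ []      g       i       = sym (+-identityˡ _)
  coeff-+ₚ (a ∷ f) []      i       = sym (+-identityʳ _)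
  coeff-+ₚ (a ∷ f) (b ∷ g) zero    = refl
  coeff-+ₚ (a ∷ f) (b ∷ g) (suc i) = coeff-+ₚ f g i

  coeff-·ₚ : ∀ c f i → coeff (c ·ₚ f) i ≡ c ⊛ coeff f i
  coeff-·ₚ c []      i       = sym (zeroʳ c)
  coeff-·ₚ c (a ∷ f) zero    = refl
  coeff-·ₚ c (a ∷ f) (suc i) = coeff-·ₚ c f i

  +ₚ-cong : ∀ {f f′ g g′} → f ≐ f′ → g ≐ g′ → f +ₚ g ≐ f′ +ₚ g′
  +ₚ-cong {f} {f′} {g} {g′} f≐f′ g≐g′ = coeffwise λ i → begin
      coeff (f +ₚ g) i        ≡⟨ coeff-+ₚ f g i ⟩
      coeff f i ⊕ coeff g i   ≡⟨ cong₂ _⊕_ (at f≐f′ i) (at g≐g′ i) ⟩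
      coeff f′ i ⊕ coeff g′ i ≡⟨ coeff-+ₚ f′ g′ i ⟨
      coeff (f′ +ₚ g′) i      ∎
    where open ≡-Reasoning

  +ₚ-identityʳ : ∀ f → f +ₚ [] ≐ f
  +ₚ-identityʳ f = coeffwise λ i → trans (coeff-+ₚ f [] i) (+-identityʳ _)

  +ₚ-interchange : ∀ f g h k → (f +ₚ g) +ₚ (h +ₚ k) ≐ (f +ₚ h) +ₚ (g +ₚ k)
  +ₚ-interchange f g h k = coeffwise λ i → begin
      coeff ((f +ₚ g) +ₚ (h +ₚ k)) i                  ≡⟨ coeff-+ₚ (f +ₚ g) (h +ₚ k) i ⟩
      coeff (f +ₚ g) i ⊕ coeff (h +ₚ k) i             ≡⟨ cong₂ _⊕_ (coeff-+ₚ f g i) (coeff-+ₚ h k i) ⟩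
      (coeff f i ⊕ coeff g i) ⊕ (coeff h i ⊕ coeff k i) ≡⟨ interchange _ _ _ _ ⟩
      (coeff f i ⊕ coeff h i) ⊕ (coeff g i ⊕ coeff k i) ≡⟨ cong₂ _⊕_ (coeff-+ₚ f h i) (coeff-+ₚ g k i) ⟨
      coeff (f +ₚ h) i ⊕ coeff (g +ₚ k) i             ≡⟨ coeff-+ₚ (f +ₚ h) (g +ₚ k) i ⟨
      coeff ((f +ₚ h) +ₚ (g +ₚ k)) i                  ∎
    where open ≡-Reasoning

  ·ₚ-cong : ∀ {c c′ f g} → c ≡ c′ → f ≐ g → c ·ₚ f ≐ c′ ·ₚ g
  ·ₚ-cong {c} {c′} {f} {g} refl f≐g = coeffwise λ i → begin
      coeff (c ·ₚ f) i ≡⟨ coeff-·ₚ c f i ⟩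
      c ⊛ coeff f i    ≡⟨ cong (c ⊛_) (at f≐g i) ⟩
      c ⊛ coeff g i    ≡⟨ coeff-·ₚ c g i ⟨
      coeff (c ·ₚ g) i ∎
    where open ≡-Reasoning

  ·ₚ-zeroˡ : ∀ f → 0# ·ₚ f ≐ []
  ·ₚ-zeroˡ f = coeffwise λ i → trans (coeff-·ₚ 0# f i) (zeroˡ _)

  ·ₚ-identityˡ : ∀ f → 1# ·ₚ f ≐ f
  ·ₚ-identityˡ f = coeffwise λ i → trans (coeff-·ₚ 1# f i) (*-identityˡ _)

  ·ₚ-assoc : ∀ a b f → a ·ₚ b ·ₚ f ≐ (a ⊛ b) ·ₚ f
  ·ₚ-assoc a b f = coeffwise λ i → begin
      coeff (a ·ₚ b ·ₚ f) i  ≡⟨ coeff-·ₚ a (b ·ₚ f) i ⟩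
      a ⊛ coeff (b ·ₚ f) i   ≡⟨ cong (a ⊛_) (coeff-·ₚ b f i) ⟩
      a ⊛ (b ⊛ coeff f i)    ≡⟨ *-assoc a b _ ⟨
      (a ⊛ b) ⊛ coeff f i    ≡⟨ coeff-·ₚ (a ⊛ b) f i ⟨
      coeff ((a ⊛ b) ·ₚ f) i ∎
    where open ≡-Reasoning

  ·ₚ-swap : ∀ a b f → a ·ₚ b ·ₚ f ≐ b ·ₚ a ·ₚ f
  ·ₚ-swap a b f = coeffwise λ i → begin
      coeff (a ·ₚ b ·ₚ f) i ≡⟨ coeff-·ₚ a (b ·ₚ f) i ⟩
      a ⊛ coeff (b ·ₚ f) i  ≡⟨ cong (a ⊛_) (coeff-·ₚ b f i) ⟩
      a ⊛ (b ⊛ coeff f i)   ≡⟨ x∙yz≈y∙xz a b _ ⟩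
      b ⊛ (a ⊛ coeff f i)   ≡⟨ cong (b ⊛_) (coeff-·ₚ a f i) ⟨
      b ⊛ coeff (a ·ₚ f) i  ≡⟨ coeff-·ₚ b (a ·ₚ f) i ⟨
      coeff (b ·ₚ a ·ₚ f) i ∎
    where open ≡-Reasoning

  ·ₚ-distribˡ-+ₚ : ∀ c f g → c ·ₚ (f +ₚ g) ≐ c ·ₚ f +ₚ c ·ₚ g
  ·ₚ-distribˡ-+ₚ c f g = coeffwise λ i → begin
      coeff (c ·ₚ (f +ₚ g)) i                 ≡⟨ coeff-·ₚ c (f +ₚ g) i ⟩
      c ⊛ coeff (f +ₚ g) i                    ≡⟨ cong (c ⊛_) (coeff-+ₚ f g i) ⟩
      c ⊛ (coeff f i ⊕ coeff g i)             ≡⟨ distribˡ c _ _ ⟩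
      c ⊛ coeff f i ⊕ c ⊛ coeff g i           ≡⟨ cong₂ _⊕_ (coeff-·ₚ c f i) (coeff-·ₚ c g i) ⟨
      coeff (c ·ₚ f) i ⊕ coeff (c ·ₚ g) i     ≡⟨ coeff-+ₚ (c ·ₚ f) (c ·ₚ g) i ⟨
      coeff (c ·ₚ f +ₚ c ·ₚ g) i              ∎
    where open ≡-Reasoning

  ·ₚ-distribʳ-⊕ : ∀ a b f → (a ⊕ b) ·ₚ f ≐ a ·ₚ f +ₚ b ·ₚ f
  ·ₚ-distribʳ-⊕ a b f = coeffwise λ i → begin
      coeff ((a ⊕ b) ·ₚ f) i              ≡⟨ coeff-·ₚ (a ⊕ b) f i ⟩
      (a ⊕ b) ⊛ coeff f i                 ≡⟨ distribʳ _ a b ⟩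
      a ⊛ coeff f i ⊕ b ⊛ coeff f i       ≡⟨ cong₂ _⊕_ (coeff-·ₚ a f i) (coeff-·ₚ b f i) ⟨
      coeff (a ·ₚ f) i ⊕ coeff (b ·ₚ f) i ≡⟨ coeff-+ₚ (a ·ₚ f) (b ·ₚ f) i ⟨
      coeff (a ·ₚ f +ₚ b ·ₚ f) i          ∎
    where open ≡-Reasoning

  module ≐-Reasoning = SetoidReasoning ≐-setoid

  [0#]≐[] : [ 0# ] ≐ []
  [0#]≐[] = coeffwise λ { zero → refl ; (suc i) → refl }

  *ₚ-congʳ : ∀ f {g g′} → g ≐ g′ → f *ₚ g ≐ f *ₚ g′
  *ₚ-congʳ []      g≐g′ = ≐-refl
  *ₚ-congʳ (a ∷ f) g≐g′ = +ₚ-cong (·ₚ-cong refl g≐g′) (∷-cong refl (*ₚ-congʳ f g≐g′))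

  *ₚ-zeroˡ : ∀ {f} g → f ≐ [] → f *ₚ g ≐ []
  *ₚ-zeroˡ {[]}    g _    = ≐-refl
  *ₚ-zeroˡ {a ∷ f} g f≐[] = ≐-trans
    (+ₚ-cong (≐-trans (·ₚ-cong (at f≐[] zero) ≐-refl) (·ₚ-zeroˡ g))
             (∷-cong refl (*ₚ-zeroˡ {f} g (coeffwise λ i → at f≐[] (suc i)))))
    [0#]≐[]

  *ₚ-zeroʳ : ∀ f {g} → g ≐ [] → f *ₚ g ≐ []
  *ₚ-zeroʳ []      g≐[] = ≐-refl
  *ₚ-zeroʳ (a ∷ f) g≐[] = ≐-trans (+ₚ-cong (·ₚ-cong refl g≐[]) (∷-cong refl (*ₚ-zeroʳ f g≐[]))) [0#]≐[]

  *ₚ-congˡ : ∀ {f f′} g → f ≐ f′ → f *ₚ g ≐ f′ *ₚ g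
  *ₚ-congˡ {[]}    {[]}     g f≐f′ = ≐-refl
  *ₚ-congˡ {[]}    {b ∷ f′} g f≐f′ = ≐-sym (*ₚ-zeroˡ g (≐-sym f≐f′))
  *ₚ-congˡ {a ∷ f} {[]}     g f≐f′ = *ₚ-zeroˡ g f≐f′
  *ₚ-congˡ {a ∷ f} {b ∷ f′} g f≐f′ =
    +ₚ-cong (·ₚ-cong (at f≐f′ zero) ≐-refl) (∷-cong refl (*ₚ-congˡ g (∷-tail f≐f′)))

  0∷-*ₚ : ∀ f g → (0# ∷ f) *ₚ g ≐ 0# ∷ f *ₚ g
  0∷-*ₚ f g = +ₚ-cong (·ₚ-zeroˡ g) ≐-refl

  *ₚ-distribʳ-+ₚ : ∀ f g h → (f +ₚ g) *ₚ h ≐ (f *ₚ h) +ₚ (g *ₚ h)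
  *ₚ-distribʳ-+ₚ []      g       h = ≐-refl
  *ₚ-distribʳ-+ₚ (a ∷ f) []      h = ≐-sym (+ₚ-identityʳ _)
  *ₚ-distribʳ-+ₚ (a ∷ f) (b ∷ g) h = begin
      (a ⊕ b) ·ₚ h +ₚ (0# ∷ (f +ₚ g) *ₚ h)
        ≈⟨ +ₚ-cong (·ₚ-distribʳ-⊕ a b h) (∷-cong (sym (+-identityˡ 0#)) (*ₚ-distribʳ-+ₚ f g h)) ⟩
      (a ·ₚ h +ₚ b ·ₚ h) +ₚ ((0# ∷ f *ₚ h) +ₚ (0# ∷ g *ₚ h))
        ≈⟨ +ₚ-interchange (a ·ₚ h) (b ·ₚ h) _ _ ⟩
      ((a ∷ f) *ₚ h) +ₚ ((b ∷ g) *ₚ h)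
        ∎
    where open ≐-Reasoning

  ·ₚ-*ₚ-assoc : ∀ c f g → (c ·ₚ f) *ₚ g ≐ c ·ₚ (f *ₚ g)
  ·ₚ-*ₚ-assoc c []      g = ≐-refl
  ·ₚ-*ₚ-assoc c (a ∷ f) g = begin
      (c ⊛ a) ·ₚ g +ₚ (0# ∷ (c ·ₚ f) *ₚ g)
        ≈⟨ +ₚ-cong (≐-sym (·ₚ-assoc c a g)) (∷-cong (sym (zeroʳ c)) (·ₚ-*ₚ-assoc c f g)) ⟩
      c ·ₚ a ·ₚ g +ₚ c ·ₚ (0# ∷ f *ₚ g)
        ≈⟨ ·ₚ-distribˡ-+ₚ c (a ·ₚ g) _ ⟨
      c ·ₚ ((a ∷ f) *ₚ g)
        ∎
    where open ≐-Reasoning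

  *ₚ-·ₚ-comm : ∀ c f g → f *ₚ (c ·ₚ g) ≐ c ·ₚ (f *ₚ g)
  *ₚ-·ₚ-comm c []      g = ≐-refl
  *ₚ-·ₚ-comm c (a ∷ f) g = begin
      a ·ₚ c ·ₚ g +ₚ (0# ∷ f *ₚ (c ·ₚ g))
        ≈⟨ +ₚ-cong (·ₚ-swap a c g) (∷-cong (sym (zeroʳ c)) (*ₚ-·ₚ-comm c f g)) ⟩
      c ·ₚ a ·ₚ g +ₚ c ·ₚ (0# ∷ f *ₚ g)
        ≈⟨ ·ₚ-distribˡ-+ₚ c (a ·ₚ g) _ ⟨
      c ·ₚ ((a ∷ f) *ₚ g)
        ∎
    where open ≐-Reasoning

  *ₚ-assoc : ∀ f g h → (f *ₚ g) *ₚ h ≐ f *ₚ (g *ₚ h)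
  *ₚ-assoc []      g h = ≐-refl
  *ₚ-assoc (a ∷ f) g h = begin
      (a ·ₚ g +ₚ (0# ∷ f *ₚ g)) *ₚ h         ≈⟨ *ₚ-distribʳ-+ₚ (a ·ₚ g) _ h ⟩
      ((a ·ₚ g) *ₚ h) +ₚ ((0# ∷ f *ₚ g) *ₚ h) ≈⟨ +ₚ-cong (·ₚ-*ₚ-assoc a g h) (0∷-*ₚ (f *ₚ g) h) ⟩
      a ·ₚ (g *ₚ h) +ₚ (0# ∷ (f *ₚ g) *ₚ h)   ≈⟨ +ₚ-cong ≐-refl (∷-cong refl (*ₚ-assoc f g h)) ⟩
      a ·ₚ (g *ₚ h) +ₚ (0# ∷ f *ₚ (g *ₚ h))   ∎
    where open ≐-Reasoning

  DegreeBelow : Pol → ℕ → Set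
  DegreeBelow f n = ∀ i → n ≤ i → coeff f i ≡ 0#

  record HasDegree (f : Pol) (m : ℕ) : Set where
    field
      below     : DegreeBelow f (suc m)
      leading≢0 : coeff f m ≢ 0#
  open HasDegree

  zero-or-degree : ∀ f → f ≐ [] ⊎ ∃ (HasDegree f)
  zero-or-degree []      = inj₁ ≐-refl
  zero-or-degree (a ∷ f) with zero-or-degree f
  ... | inj₂ (m , deg) = inj₂ (suc m , record
          { below     = λ { zero () ; (suc i) (s≤s m<i) → below deg i m<i }
          ; leading≢0 = leading≢0 deg })
  ... | inj₁ f≐[] with a ≟ 0#
  ...   | yes a≡0 = inj₁ (≐-trans (∷-cong a≡0 f≐[]) [0#]≐[])
  ...   | no  a≢0 = inj₂ (0 , record { below = λ { zero () ; (suc i) _ → at f≐[] i } ; leading≢0 = a≢0 })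

  HasDegree-resp : ∀ {f g m} → f ≐ g → HasDegree f m → HasDegree g m
  HasDegree-resp f≐g deg = record
    { below     = λ i m<i → trans (sym (at f≐g i)) (below deg i m<i)
    ; leading≢0 = λ gₘ≡0 → leading≢0 deg (trans (at f≐g _) gₘ≡0) }

  degree-unique : ∀ {f m n} → HasDegree f m → HasDegree f n → m ≡ n
  degree-unique {m = m} {n} degₘ degₙ with <-cmp m n
  ... | tri< m<n _ _ = contradiction (below degₘ n m<n) (leading≢0 degₙ)
  ... | tri≈ _ m≡n _ = m≡n
  ... | tri> _ _ n<m = contradiction (below degₙ m n<m) (leading≢0 degₘ)

  coeff-*ₚ : ∀ a f g i → coeff ((a ∷ f) *ₚ g) i ≡ a ⊛ coeff g i ⊕ coeff (0# ∷ f *ₚ g) i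
  coeff-*ₚ a f g i = trans (coeff-+ₚ (a ·ₚ g) _ i) (cong (_⊕ _) (coeff-·ₚ a g i))

  *ₚ-leadingCoeff : ∀ f g a b → DegreeBelow f (suc a) → DegreeBelow g (suc b) →
                    DegreeBelow (f *ₚ g) (suc (a + b)) × coeff (f *ₚ g) (a + b) ≡ coeff f a ⊛ coeff g b
  *ₚ-leadingCoeff []      g a       b f<a g<b = (λ _ _ → refl) , sym (zeroˡ _)
  *ₚ-leadingCoeff (x ∷ f) g zero    b f<a g<b = product<b , product-b
    where
    f*g≐[] : 0# ∷ f *ₚ g ≐ []
    f*g≐[] = ≐-trans (∷-cong refl (*ₚ-zeroˡ {f} g (coeffwise λ i → f<a (suc i) (s≤s z≤n)))) [0#]≐[]
    product<b : DegreeBelow ((x ∷ f) *ₚ g) (suc b)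
    product<b i b<i = begin
      coeff ((x ∷ f) *ₚ g) i                 ≡⟨ coeff-*ₚ x f g i ⟩
      x ⊛ coeff g i ⊕ coeff (0# ∷ f *ₚ g) i  ≡⟨ cong₂ _⊕_ (trans (cong (x ⊛_) (g<b i b<i)) (zeroʳ x)) (at f*g≐[] i) ⟩
      0# ⊕ 0#                                ≡⟨ +-identityˡ 0# ⟩
      0#                                     ∎
      where open ≡-Reasoning
    product-b : coeff ((x ∷ f) *ₚ g) b ≡ x ⊛ coeff g b
    product-b = trans (coeff-*ₚ x f g b) (trans (cong (x ⊛ coeff g b ⊕_) (at f*g≐[] b)) (+-identityʳ _))
  *ₚ-leadingCoeff (x ∷ f) g (suc a) b f<a g<b = product<a+b , product-a+b
    where
    ih = *ₚ-leadingCoeff f g a b (λ i a<i → f<a (suc i) (s≤s a<i)) g<b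
    x*g-vanishes : ∀ i → b < i → x ⊛ coeff g i ≡ 0#
    x*g-vanishes i b<i = trans (cong (x ⊛_) (g<b i b<i)) (zeroʳ x)
    product<a+b : DegreeBelow ((x ∷ f) *ₚ g) (suc (suc a + b))
    product<a+b (suc i) (s≤s a+b<i) = begin
      coeff ((x ∷ f) *ₚ g) (suc i)         ≡⟨ coeff-*ₚ x f g (suc i) ⟩
      x ⊛ coeff g (suc i) ⊕ coeff (f *ₚ g) i ≡⟨ cong₂ _⊕_ (x*g-vanishes (suc i) (s≤s (≤-trans (m≤n+m b a) (<⇒≤ a+b<i)))) (proj₁ ih i a+b<i) ⟩
      0# ⊕ 0#                              ≡⟨ +-identityˡ 0# ⟩
      0#                                   ∎
      where open ≡-Reasoning
    product-a+b : coeff ((x ∷ f) *ₚ g) (suc a + b) ≡ coeff f a ⊛ coeff g b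
    product-a+b = begin
      coeff ((x ∷ f) *ₚ g) (suc (a + b))           ≡⟨ coeff-*ₚ x f g (suc (a + b)) ⟩
      x ⊛ coeff g (suc (a + b)) ⊕ coeff (f *ₚ g) (a + b) ≡⟨ cong (_⊕ coeff (f *ₚ g) (a + b)) (x*g-vanishes (suc (a + b)) (s≤s (m≤n+m b a))) ⟩
      0# ⊕ coeff (f *ₚ g) (a + b)                  ≡⟨ +-identityˡ _ ⟩
      coeff (f *ₚ g) (a + b)                       ≡⟨ proj₂ ih ⟩
      coeff f a ⊛ coeff g b                        ∎
      where open ≡-Reasoning

  toPol-below : ∀ {n} (v : Monic n) → DegreeBelow (toPol v) (suc n)
  toPol-below []ᵥ       (suc i) _         = refl
  toPol-below (x ∷ᵥ v)  (suc i) (s≤s n<i) = toPol-below v i n<i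

  toPol-leading : ∀ {n} (v : Monic n) → coeff (toPol v) n ≡ 1#
  toPol-leading []ᵥ      = refl
  toPol-leading (x ∷ᵥ v) = toPol-leading v

  toPol-degree : ∀ {n} (v : Monic n) → HasDegree (toPol v) n
  toPol-degree v = record
    { below     = toPol-below v
    ; leading≢0 = λ vₙ≡0 → 0≢1 (trans (sym vₙ≡0) (toPol-leading v)) }

  toPol≉[] : ∀ {n} (v : Monic n) → ¬ toPol v ≐ []
  toPol≉[] {n} v v≐[] = 0≢1 (trans (sym (at v≐[] n)) (toPol-leading v))

  tailₚ : Pol → Pol
  tailₚ []      = []
  tailₚ (a ∷ f) = f

  coeff-tailₚ : ∀ f i → coeff (tailₚ f) i ≡ coeff f (suc i)
  coeff-tailₚ []      i = refl
  coeff-tailₚ (a ∷ f) i = refl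

  fromPol : (m : ℕ) → Pol → Monic m
  fromPol zero    f = []ᵥ
  fromPol (suc m) f = coeff f 0 ∷ᵥ fromPol m (tailₚ f)

  fromPol-cong : ∀ m {f g} → f ≐ g → fromPol m f ≡ fromPol m g
  fromPol-cong zero    f≐g = refl
  fromPol-cong (suc m) {f} {g} f≐g = cong₂ _∷ᵥ_ (at f≐g 0) (fromPol-cong m (coeffwise λ i → begin
      coeff (tailₚ f) i ≡⟨ coeff-tailₚ f i ⟩
      coeff f (suc i)   ≡⟨ at f≐g (suc i) ⟩
      coeff g (suc i)   ≡⟨ coeff-tailₚ g i ⟨
      coeff (tailₚ g) i ∎))
    where open ≡-Reasoning

  fromPol-toPol : ∀ {n} (v : Monic n) → fromPol n (toPol v) ≡ v
  fromPol-toPol []ᵥ      = refl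
  fromPol-toPol (x ∷ᵥ v) = cong (x ∷ᵥ_) (fromPol-toPol v)

  fromPol-≐toPol : ∀ {n f} {v : Monic n} → f ≐ toPol v → fromPol n f ≡ v
  fromPol-≐toPol {n} {v = v} f≐v = trans (fromPol-cong n f≐v) (fromPol-toPol v)

  toPol-fromPol : ∀ m f → DegreeBelow f (suc m) → coeff f m ≡ 1# → toPol (fromPol m f) ≐ f
  toPol-fromPol zero    f f<1 f₀≡1 = coeffwise λ { zero → sym f₀≡1 ; (suc i) → sym (f<1 (suc i) (s≤s z≤n)) }
  toPol-fromPol (suc m) f f<m fₘ≡1 = coeffwise λ { zero → refl ; (suc i) → trans (at ih i) (coeff-tailₚ f i) }
    where
    ih = toPol-fromPol m (tailₚ f) (λ i m<i → trans (coeff-tailₚ f i) (f<m (suc i) (s≤s m<i)))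
                                   (trans (coeff-tailₚ f m) fₘ≡1)

  monic-cofactor : ∀ {d N} (D : Monic d) (G : Monic N) {h} → toPol D *ₚ h ≐ toPol G →
                   d ≤ N × h ≐ toPol (fromPol (N ∸ d) h)
  monic-cofactor {d} {N} D G {h} D*h≐G with zero-or-degree h
  ... | inj₁ h≐[] = contradiction (≐-trans (≐-sym D*h≐G) (*ₚ-zeroʳ (toPol D) h≐[])) (toPol≉[] G)
  ... | inj₂ (m , deg) = d≤N , h≐monic
    where
    product = *ₚ-leadingCoeff (toPol D) h d m (toPol-below D) (below deg)
    leading-D*h : coeff (toPol D *ₚ h) (d + m) ≡ coeff h m
    leading-D*h = trans (proj₂ product) (trans (cong (_⊛ coeff h m) (toPol-leading D)) (*-identityˡ _))
    d+m≡N : d + m ≡ N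
    d+m≡N = degree-unique (HasDegree-resp D*h≐G (record
      { below = proj₁ product ; leading≢0 = λ e → leading≢0 deg (trans (sym leading-D*h) e) }))
      (toPol-degree G)
    d≤N : d ≤ N
    d≤N = subst (d ≤_) d+m≡N (m≤m+n d m)
    hₘ≡1 : coeff h m ≡ 1#
    hₘ≡1 = begin
      coeff h m                     ≡⟨ leading-D*h ⟨
      coeff (toPol D *ₚ h) (d + m)  ≡⟨ at D*h≐G (d + m) ⟩
      coeff (toPol G) (d + m)       ≡⟨ cong (coeff (toPol G)) d+m≡N ⟩
      coeff (toPol G) N             ≡⟨ toPol-leading G ⟩
      1#                            ∎
      where open ≡-Reasoning
    h≐monic : h ≐ toPol (fromPol (N ∸ d) h)
    h≐monic = subst (λ k → h ≐ toPol (fromPol k h)) (trans (sym (m+n∸m≡n d m)) (cong (_∸ d) d+m≡N))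
                    (≐-sym (toPol-fromPol m h (below deg) hₘ≡1))

  ^ₚ-2+-*ₚ : ∀ p k h → (p ^ₚ suc (suc k)) *ₚ h ≐ p *ₚ (p *ₚ ((p ^ₚ k) *ₚ h))
  ^ₚ-2+-*ₚ p k h = ≐-trans (*ₚ-assoc p (p *ₚ (p ^ₚ k)) h) (*ₚ-congʳ p (*ₚ-assoc p (p ^ₚ k) h))

  ·ₚ-*ₚ-shift : ∀ c f g → (c ·ₚ f) *ₚ g ≐ f *ₚ (c ·ₚ g)
  ·ₚ-*ₚ-shift c f g = ≐-trans (·ₚ-*ₚ-assoc c f g) (≐-sym (*ₚ-·ₚ-comm c f g))

  record MonicAssociate (p : Pol) (m : ℕ) : Set where
    field
      scalar      : Carrier
      monic       : Monic m
      p≐scalar·ₚ  : p ≐ scalar ·ₚ toPol monic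

  monicAssociate : ∀ {p m} → HasDegree p m → MonicAssociate p m
  monicAssociate {p} {m} deg = record { scalar = c ; monic = fromPol m (c⁻¹ ·ₚ p) ; p≐scalar·ₚ = p≐c·monic }
    where
    c    = coeff p m
    c⁻¹  = proj₁ (inverse c (leading≢0 deg))
    c*c⁻¹≡1 : c ⊛ c⁻¹ ≡ 1#
    c*c⁻¹≡1 = proj₂ (inverse c (leading≢0 deg))
    monic≐c⁻¹·p : toPol (fromPol m (c⁻¹ ·ₚ p)) ≐ c⁻¹ ·ₚ p
    monic≐c⁻¹·p = toPol-fromPol m (c⁻¹ ·ₚ p)
      (λ i m<i → trans (coeff-·ₚ c⁻¹ p i) (trans (cong (c⁻¹ ⊛_) (below deg i m<i)) (zeroʳ c⁻¹)))
      (trans (coeff-·ₚ c⁻¹ p m) (trans (*-comm c⁻¹ c) c*c⁻¹≡1))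
    p≐c·monic : p ≐ c ·ₚ toPol (fromPol m (c⁻¹ ·ₚ p))
    p≐c·monic = begin
      p                               ≈⟨ ·ₚ-identityˡ p ⟨
      1# ·ₚ p                         ≡⟨ cong (_·ₚ p) c*c⁻¹≡1 ⟨
      (c ⊛ c⁻¹) ·ₚ p                  ≈⟨ ·ₚ-assoc c c⁻¹ p ⟨
      c ·ₚ c⁻¹ ·ₚ p                   ≈⟨ ·ₚ-cong refl monic≐c⁻¹·p ⟨
      c ·ₚ toPol (fromPol m (c⁻¹ ·ₚ p)) ∎
      where open ≐-Reasoning

  monicAssociate-*ₚ : ∀ {p m} (A : MonicAssociate p m) X →
                      p *ₚ X ≐ toPol (MonicAssociate.monic A) *ₚ (MonicAssociate.scalar A ·ₚ X)
  monicAssociate-*ₚ A X = ≐-trans (*ₚ-congˡ X p≐scalar·ₚ) (·ₚ-*ₚ-shift scalar (toPol monic) X)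
    where open MonicAssociate A

  degree0⇒IsUnit : ∀ {p} → HasDegree p 0 → IsUnit p
  degree0⇒IsUnit {p} deg = [ c⁻¹ ] , ≐⇒≈ₚ (coeffwise λ
      { zero    → trans (proj₂ product) (proj₂ (inverse (coeff p 0) (leading≢0 deg)))
      ; (suc i) → proj₁ product (suc i) (s≤s z≤n) })
    where
    c⁻¹ = proj₁ (inverse (coeff p 0) (leading≢0 deg))
    product = *ₚ-leadingCoeff p [ c⁻¹ ] 0 0 (below deg) (λ { (suc i) _ → refl })

  unit⊎monicAssociate : ∀ {n} (F : Monic n) {p h} → p *ₚ h ≐ toPol F →
                        IsUnit p ⊎ ∃ λ m → MonicAssociate p (suc m)
  unit⊎monicAssociate F {p} {h} p*h≐F with zero-or-degree p
  ... | inj₁ p≐[]          = contradiction (≐-trans (≐-sym p*h≐F) (*ₚ-zeroˡ h p≐[])) (toPol≉[] F)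
  ... | inj₂ (zero  , deg) = inj₁ (degree0⇒IsUnit deg)
  ... | inj₂ (suc m , deg) = inj₂ (m , monicAssociate deg)

  private
    instance
      q≢0 : ℕ.NonZero q
      q≢0 = ℕ.>-nonZero (≤-trans (s≤s z≤n) (fieldSize≥2 K))

  elements : List Carrier
  elements = map (Inverse.from card) (allFin q)

  monics : (n : ℕ) → List (Monic n)
  monics zero    = [ []ᵥ ]
  monics (suc n) = cartesianProductWith _∷ᵥ_ elements (monics n)

  length-monics : ∀ n → length (monics n) ≡ q ^ n
  length-monics zero    = refl
  length-monics (suc n) = begin
      length (cartesianProductWith _∷ᵥ_ elements (monics n)) ≡⟨ length-cartesianProductWith _∷ᵥ_ elements (monics n) ⟩
      length elements * length (monics n)                   ≡⟨ cong₂ _*_ length-elements (length-monics n) ⟩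
      q * q ^ n                                             ∎
    where
    open ≡-Reasoning
    length-elements : length elements ≡ q
    length-elements = trans (length-map _ (allFin q)) (length-tabulate (λ i → i))

  ∈-monics : ∀ {n} (v : Monic n) → v ∈ monics n
  ∈-monics []ᵥ      = here refl
  ∈-monics (x ∷ᵥ v) = ∈-cartesianProductWith⁺ _∷ᵥ_ ∈-elements (∈-monics v)
    where
    ∈-elements : x ∈ elements
    ∈-elements = subst (_∈ elements) (Inverse.strictlyInverseʳ card x) (∈-map⁺ (Inverse.from card) (∈-allFin _))

  monics-unique : ∀ n → Unique (monics n)
  monics-unique zero    = All.[] ∷ []
  monics-unique (suc n) = Unique.cartesianProductWith⁺ _∷ᵥ_ ∷ᵥ-injective
      (Unique.map⁺ (Injection.injective (↔⇒↣ (↔-sym card))) (Unique.allFin⁺ q))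
      (monics-unique n)
    where
    ∷ᵥ-injective : ∀ {a b} {u v : Monic n} → a ∷ᵥ u ≡ b ∷ᵥ v → a ≡ b × u ≡ v
    ∷ᵥ-injective refl = refl , refl

  module _ (N : ℕ) where

    multiples : ∀ {d} → Monic d → List (Monic N)
    multiples {d} D = map (λ H → fromPol N (toPol D *ₚ toPol H)) (monics (N ∸ d))

    length-multiples : ∀ {d} (D : Monic d) → length (multiples D) ≡ q ^ (N ∸ d)
    length-multiples {d} D = trans (length-map _ (monics (N ∸ d))) (length-monics (N ∸ d))

    ∈-multiples : ∀ {d} (D : Monic d) {h} (G : Monic N) → toPol D *ₚ h ≐ toPol G → G ∈ multiples D
    ∈-multiples {d} D {h} G D*h≐G = subst (_∈ multiples D) D*H≡G (∈-map⁺ _ (∈-monics H))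
      where
      H = fromPol (N ∸ d) h
      D*H≡G : fromPol N (toPol D *ₚ toPol H) ≡ G
      D*H≡G = fromPol-≐toPol (≐-trans (*ₚ-congʳ (toPol D) (≐-sym (proj₂ (monic-cofactor D G D*h≐G)))) D*h≐G)

    squareMultiples : ℕ → List (Monic N)
    squareMultiples d with d ≤? N ∸ d
    ... | yes _ = cartesianProductWith (λ P H → fromPol N (toPol P *ₚ (toPol P *ₚ toPol H)))
                                       (monics d) (monics (N ∸ d ∸ d))
    ... | no  _ = []

    length-squareMultiples : ∀ d → length (squareMultiples d) ≤ q ^ (N ∸ d)
    length-squareMultiples d with d ≤? N ∸ d
    ... | no  _     = z≤n
    ... | yes 2d≤N = ≤-reflexive (begin
      length (cartesianProductWith _ (monics d) (monics (N ∸ d ∸ d))) ≡⟨ length-cartesianProductWith _ (monics d) _ ⟩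
      length (monics d) * length (monics (N ∸ d ∸ d))                 ≡⟨ cong₂ _*_ (length-monics d) (length-monics (N ∸ d ∸ d)) ⟩
      q ^ d * q ^ (N ∸ d ∸ d)                                         ≡⟨ ^-distribˡ-+-* q d (N ∸ d ∸ d) ⟨
      q ^ (d + (N ∸ d ∸ d))                                           ≡⟨ cong (q ^_) (m+[n∸m]≡n 2d≤N) ⟩
      q ^ (N ∸ d)                                                     ∎)
      where open ≡-Reasoning

    square-cofactor : ∀ {d} (P : Monic d) {h} (G : Monic N) → toPol P *ₚ (toPol P *ₚ h) ≐ toPol G →
                      d ≤ N ∸ d × h ≐ toPol (fromPol (N ∸ d ∸ d) h)
    square-cofactor {d} P {h} G P*P*h≐G =
      monic-cofactor P (fromPol (N ∸ d) (toPol P *ₚ h)) {h} (proj₂ (monic-cofactor P G P*P*h≐G))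

    ∈-squareMultiples : ∀ {d} (P : Monic d) {h} (G : Monic N) → toPol P *ₚ (toPol P *ₚ h) ≐ toPol G →
                        G ∈ squareMultiples d
    ∈-squareMultiples {d} P {h} G P*P*h≐G with d ≤? N ∸ d
    ... | no  2d≰N = contradiction (proj₁ (square-cofactor P G P*P*h≐G)) 2d≰N
    ... | yes _    = subst (_∈ _) P*P*H≡G (∈-cartesianProductWith⁺ _ (∈-monics P) (∈-monics H))
      where
      H = fromPol (N ∸ d ∸ d) h
      P*P*H≐G : toPol P *ₚ (toPol P *ₚ toPol H) ≐ toPol G
      P*P*H≐G = ≐-trans (*ₚ-congʳ (toPol P) (*ₚ-congʳ (toPol P) (≐-sym (proj₂ (square-cofactor P G P*P*h≐G)))))
                        P*P*h≐G
      P*P*H≡G : fromPol N (toPol P *ₚ (toPol P *ₚ toPol H)) ≡ G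
      P*P*H≡G = fromPol-≐toPol P*P*H≐G

    ∈-squareMultiples⇒≤ : ∀ {d G} → G ∈ squareMultiples d → d ≤ N
    ∈-squareMultiples⇒≤ {d} G∈ with d ≤? N ∸ d
    ... | yes 2d≤N = ≤-trans 2d≤N (m∸n≤m N d)
    ∈-squareMultiples⇒≤ () | no _

    squareful : ℕ → List (Monic N)
    squareful zero    = []
    squareful (suc j) = squareMultiples (suc j) ++ squareful j

    ∈-squareful : ∀ {d j G} → 1 ≤ d → d ≤ j → G ∈ squareMultiples d → G ∈ squareful j
    ∈-squareful {j = zero}  (s≤s _) () _
    ∈-squareful {j = suc j} 1≤d d≤1+j G∈ with m≤n⇒m<n∨m≡n d≤1+j
    ... | inj₂ refl         = ∈-++⁺ˡ G∈
    ... | inj₁ (s≤s d≤j)    = ∈-++⁺ʳ (squareMultiples (suc j)) (∈-squareful 1≤d d≤j G∈)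

    length-squareful : 3 ≤ q → 2 * length (squareful N) < q ^ N
    length-squareful q≥3 = begin
        suc (2 * s N)           ≡⟨ +-comm 1 (2 * s N) ⟩
        2 * s N + 1             ≡⟨ cong (λ e → 2 * s N + q ^ e) (n∸n≡0 N) ⟨
        2 * s N + q ^ (N ∸ N)   ≤⟨ geometric-bound q≥3 s refl step N ≤-refl ⟩
        q ^ N                   ∎
      where
      open ≤-Reasoning
      s : ℕ → ℕ
      s j = length (squareful j)
      step : ∀ j → s (suc j) ≤ q ^ (N ∸ suc j) + s j
      step j = ≤-trans (≤-reflexive (length-++ (squareMultiples (suc j))))
                       (+-monoˡ-≤ (s j) (length-squareMultiples (suc j)))

    ∉squareful⇒powerFree : ∀ k {G} → G ∉ squareful N → InH (suc (suc k)) N G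
    ∉squareful⇒powerFree k {G} G∉ p (h , p^r*h≈G)
      with unit⊎monicAssociate G {p} (≐-trans (≐-sym (^ₚ-2+-*ₚ p k h)) (≈ₚ⇒≐ p^r*h≈G))
    ... | inj₁ p-unit = p-unit
    ... | inj₂ (m , A) = contradiction (∈-squareful (s≤s z≤n) (∈-squareMultiples⇒≤ G∈) G∈) G∉
      where
      open MonicAssociate A
      W = (p ^ₚ k) *ₚ h
      G∈ : G ∈ squareMultiples (suc m)
      G∈ = ∈-squareMultiples monic G (begin
        toPol monic *ₚ (toPol monic *ₚ (scalar ·ₚ scalar ·ₚ W))  ≈⟨ *ₚ-congʳ (toPol monic) (*ₚ-·ₚ-comm scalar (toPol monic) _) ⟩
        toPol monic *ₚ (scalar ·ₚ (toPol monic *ₚ (scalar ·ₚ W))) ≈⟨ *ₚ-congʳ (toPol monic) (·ₚ-cong refl (monicAssociate-*ₚ A W)) ⟨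
        toPol monic *ₚ (scalar ·ₚ (p *ₚ W))                       ≈⟨ monicAssociate-*ₚ A (p *ₚ W) ⟨
        p *ₚ (p *ₚ W)                                             ≈⟨ ^ₚ-2+-*ₚ p k h ⟨
        (p ^ₚ suc (suc k)) *ₚ h                                   ≈⟨ ≈ₚ⇒≐ p^r*h≈G ⟩
        toPol G                                                   ∎)
        where open ≐-Reasoning

    -- The only monic polynomial of degree 0 is 1, which never witnesses a common factor.
    nonunitMultiples : AnyMonic → List (Monic N)
    nonunitMultiples (zero  , _) = []
    nonunitMultiples (suc _ , D) = multiples D

    divisorMultiples : List AnyMonic → List (Monic N)
    divisorMultiples = concatMap nonunitMultiples

    length-divisorMultiples : ∀ Ds → length (divisorMultiples Ds) ≤ length Ds * q ^ (N ∸ 1)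
    length-divisorMultiples = length-concatMap-≤ nonunitMultiples bound
      where
      bound : ∀ D → length (nonunitMultiples D) ≤ q ^ (N ∸ 1)
      bound (zero  , _) = z≤n
      bound (suc _ , D) = ≤-trans (≤-reflexive (length-multiples D)) (^-monoʳ-≤ q (∸-monoʳ-≤ N (s≤s z≤n)))

    ∉divisorMultiples⇒coprime : ∀ F {Ds} → (∀ D → anyToPol D ∣ₚ anyToPol F → D ∈ Ds) →
                                ∀ {G} → G ∉ divisorMultiples Ds → ChiFrIsOne F G
    ∉divisorMultiples⇒coprime (_ , F) divisor∈Ds {G} G∉ d (h₁ , d*h₁≈F) (h₂ , d*h₂≈G)
      with unit⊎monicAssociate F {d} (≈ₚ⇒≐ d*h₁≈F)
    ... | inj₁ d-unit = d-unit
    ... | inj₂ (m , A) = contradiction (∈-concatMap⁺ nonunitMultiples (lose P∈Ds (∈-multiples monic G P*h₂≐G))) G∉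
      where
      open MonicAssociate A
      P∈Ds : (suc m , monic) ∈ _
      P∈Ds = divisor∈Ds (suc m , monic)
               (scalar ·ₚ h₁ , ≐⇒≈ₚ (≐-trans (≐-sym (monicAssociate-*ₚ A h₁)) (≈ₚ⇒≐ d*h₁≈F)))
      P*h₂≐G : toPol monic *ₚ (scalar ·ₚ h₂) ≐ toPol G
      P*h₂≐G = ≐-trans (≐-sym (monicAssociate-*ₚ A h₂)) (≈ₚ⇒≐ d*h₂≈G)

    powerFree-count : ∀ k {Hs} → Enumerates (InH (suc (suc k)) N) Hs → q ^ N ≤ length Hs + length (squareful N)
    powerFree-count k {Hs} (_ , member) = subst (_≤ length Hs + length (squareful N)) (length-monics N)
      (length-cover (≡-dec _≟_) (monics-unique N) λ {G} _ G∉ → proj₂ (member G) (∉squareful⇒powerFree k G∉))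

    coprime-count : ∀ {r} F {Hs Cs Ds} → Enumerates (InH r N) Hs →
                    Enumerates (λ G → InH r N G × ChiFrIsOne F G) Cs →
                    Enumerates (λ D → anyToPol D ∣ₚ anyToPol F) Ds →
                    length Hs ≤ length Cs + length (divisorMultiples Ds)
    coprime-count F (uniqueH , memberH) (_ , memberC) (_ , memberD) = length-cover (≡-dec _≟_) uniqueH λ {G} G∈Hs G∉ →
      proj₂ (memberC G) (proj₁ (memberH G) G∈Hs , ∉divisorMultiples⇒coprime F (λ D → proj₂ (memberD D)) G∉)

    deviation-bound : ∀ k → 3 ≤ q → 1 ≤ N → ∀ F {Hs Cs Ds} →
                      Enumerates (InH (suc (suc k)) N) Hs →
                      Enumerates (λ G → InH (suc (suc k)) N G × ChiFrIsOne F G) Cs →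
                      Enumerates (λ D → anyToPol D ∣ₚ anyToPol F) Ds →
                      ∣ + length Cs - + length Hs ∣ * q ≤ 2 * length Ds * length Hs
    deviation-bound k q≥3 N≥1 F {Hs} {Cs} {Ds} enumH@(_ , memberH) enumC@(uniqueC , memberC) enumD = begin
        ∣ + c - + h ∣ * q                  ≡⟨ cong (_* q) ∣c-h∣≡h∸c ⟩
        (h ∸ c) * q                        ≤⟨ *-monoˡ-≤ q (m≤n+o⇒m∸n≤o h c h≤c+multiples) ⟩
        length (divisorMultiples Ds) * q   ≤⟨ *-monoˡ-≤ q (length-divisorMultiples Ds) ⟩
        τ * q ^ (N ∸ 1) * q                ≡⟨ rearrange₁ τ (q ^ (N ∸ 1)) q ⟩
        τ * q ^ suc (N ∸ 1)                ≡⟨ cong (λ e → τ * q ^ e) (m+[n∸m]≡n N≥1) ⟩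
        τ * q ^ N                          ≤⟨ *-monoʳ-≤ τ q^N≤2h ⟩
        τ * (2 * h)                        ≡⟨ rearrange₂ τ h ⟩
        2 * τ * h                          ∎
      where
      open ≤-Reasoning
      h = length Hs
      c = length Cs
      τ = length Ds
      c≤h : c ≤ h
      c≤h = unique-⊆⇒length≤ uniqueC λ {G} G∈Cs → proj₂ (memberH G) (proj₁ (proj₁ (memberC G) G∈Cs))
      ∣c-h∣≡h∸c : ∣ + c - + h ∣ ≡ h ∸ c
      ∣c-h∣≡h∸c = trans (cong ∣_∣ (ℤ.m-n≡m⊖n c h)) (ℤ.∣⊖∣-≤ c≤h)
      h≤c+multiples : h ≤ c + length (divisorMultiples Ds)
      h≤c+multiples = coprime-count {r = suc (suc k)} F enumH enumC enumD
      q^N≤2h : q ^ N ≤ 2 * h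
      q^N≤2h = m≤n+o∧2o<m⇒m≤2n {n = h} (powerFree-count k enumH) (length-squareful q≥3)
      rearrange₁ : ∀ τ t q → τ * t * q ≡ τ * (q * t)
      rearrange₁ = solve-∀
      rearrange₂ : ∀ τ h → τ * (2 * h) ≡ 2 * τ * h
      rearrange₂ = solve-∀

corollary3p2 : (r : ℕ) → 2 ≤ r → ∃ λ (C : ℕ) →
    (q : ℕ) (K : FiniteField q) → (2 * r) ∣ (q ∸ 1) →
    (N : ℕ) → r ≤ N → (F : Poly.AnyMonic K) →
    (Hs : List (Poly.Monic K N)) → Enumerates (Poly.InH K r N) Hs →
    (Cs : List (Poly.Monic K N)) → Enumerates (λ G → Poly.InH K r N G × Poly.ChiFrIsOne K F G) Cs →
    (Ds : List (Poly.AnyMonic K)) → Enumerates (λ D → Poly._∣ₚ_ K (Poly.anyToPol K D) (Poly.anyToPol K F)) Ds →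
    ∣ (+ length Cs) - (+ length Hs) ∣ * q ≤ C * length Ds * length Hs
corollary3p2 (suc (suc k)) (s≤s (s≤s z≤n)) = 2 , λ q K 2r∣q-1 N r≤N F Hs enumH Cs enumC Ds enumD →
  deviation-bound K N k (fieldSize≥3 K (s≤s (s≤s z≤n)) 2r∣q-1) (≤-trans (s≤s z≤n) r≤N) F enumH enumC enumD
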